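{- Let $d$ be a negative even integer. Then the equation $x+y-z=d$ admits no EGZ-generalization, i.e. $R(x+y-z=d,2)\neq R(x+y-z=d,\mathbb{Z}/3\mathbb{Z})$.
   Context: $[1,n]=\{1,\dots,n\}$. For an equation $\mathcal{L}$ in three variables and a coloring $\chi:[1,n]\to\{0,\dots,r-1\}$, a solution $(x_1,x_2,x_3)\in[1,n]^3$ is monochromatic if all $\chi(x_i)$ are equal, and zero-sum (for $r=3$) if $\chi(x_1)+\chi(x_2)+\chi(x_3)\equiv0\pmod 3$. $R(\mathcal{L},2)$ is the least $N$ (if it exists) such that for all $n\ge N$ every $2$-coloring of $[1,n]$ has a monochromatic solution of $\mathcal{L}$; $R(\mathcal{L},\mathbb{Z}/3\mathbb{Z})$ is the least $N$ (if it exists) such that for all $n\ge N$ every map $[1,n]\to\{0,1,2\}$ has a zero-sum solution of $\mathcal{L}$. $\mathcal{L}$ admits an EGZ-generalization if $R(\mathcal{L},2)=R(\mathcal{L},\mathbb{Z}/3\mathbb{Z})$. -}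

module Defs where

open import Data.Nat using (ℕ; _≤_; _<_; _+_; _%_)
open import Data.Integer as ℤ using (ℤ; +_; _-_)
open import Data.Fin using (Fin; toℕ)
open import Data.Product using (Σ; ∃; _×_)
open import Relation.Binary.PropositionalEquality using (_≡_)
open import Relation.Nullary using (¬_)

Equation : Set₁
Equation = ℕ → ℕ → ℕ → Set

xyz-eq : ℤ → Equation
xyz-eq d x y z = ((+ x) ℤ.+ (+ y)) - (+ z) ≡ d

InRange : ℕ → ℕ → Set
InRange n x = 1 ≤ x × x ≤ n

Sol : Equation → ℕ → ℕ → ℕ → ℕ → Set
Sol L n x y z = InRange n x × InRange n y × InRange n z × L x y z

-- A coloring of [1,n] is represented by a map ℕ → Fin r (only values on [1,n] matter).
-- Every 2-coloring of [1,n] has a monochromatic solution.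
Mono2 : Equation → ℕ → Set
Mono2 L n = (χ : ℕ → Fin 2) →
  ∃ λ x → ∃ λ y → ∃ λ z → Sol L n x y z × χ x ≡ χ y × χ y ≡ χ z

ZeroSum3 : Equation → ℕ → Set
ZeroSum3 L n = (χ : ℕ → Fin 3) →
  ∃ λ x → ∃ λ y → ∃ λ z → Sol L n x y z × (toℕ (χ x) + toℕ (χ y) + toℕ (χ z)) % 3 ≡ 0

IsLeastThreshold : (ℕ → Set) → ℕ → Set
IsLeastThreshold P N =
  ((n : ℕ) → N ≤ n → P n) × ((M : ℕ) → M < N → ¬ ((n : ℕ) → M ≤ n → P n))

IsR2 : Equation → ℕ → Set
IsR2 L = IsLeastThreshold (Mono2 L)

IsRZ3 : Equation → ℕ → Set
IsRZ3 L = IsLeastThreshold (ZeroSum3 L)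

AdmitsEGZ : Equation → Set
AdmitsEGZ L = ∃ λ N → IsR2 L N × IsRZ3 L N

-- With d = -c the equation reads z = x + y + c.  The points aₖ = 1 + k(c+1)
-- satisfy aᵢ + aⱼ + c = a₍ᵢ₊ⱼ₊₁₎, so a₀,…,a₄ carry a copy of the Schur triples
-- of [1,5]; since every 2-colouring of [1,5] has a monochromatic Schur triple,
-- R(x+y-z=d, 2) ≤ a₄ = 4c+5.  On the other hand, colour odd numbers 0 and even
-- numbers 2 inside the block (a₁, a₃] and 1 outside it.  As c is even, a
-- zero-sum solution consists of three even numbers of one colour, i.e. from one
-- block; but x + y + c leaves the middle block, and lands in it when x, y lie
-- outside it and x + y + c ≤ a₄.  So R(x+y-z=d, ℤ/3ℤ) > 4c+5.
module Submission where

open import Defs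
open import Data.Integer using (ℤ; _<_; +_; _*_)
open import Data.Product using (∃)
open import Relation.Binary.PropositionalEquality using (_≡_)
open import Relation.Nullary using (¬_)

open import Data.Bool using (Bool; true; false; if_then_else_)
open import Data.Empty using (⊥)
open import Data.Fin using (Fin; toℕ; zero; suc)
open import Data.Integer as ℤ using (-[1+_]; -_; _-_; +<+)
import Data.Integer.Properties as ℤ
open import Algebra.Properties.AbelianGroup ℤ.+-0-abelianGroup using (∙-cancelˡ)
open import Data.Integer.Tactic.RingSolver using (solve-∀)
open import Data.Nat as ℕ using (ℕ; suc; _≤_; _≤?_; _<?_; z≤n; s≤s; parity)
open import Data.Nat.Properties
  using (≤-refl; ≤-trans; n≤1+n; m≤m+n; m≤n+m; m≤n⇒m≤1+n; <⇒≱; ≮⇒≥; ≰⇒>;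
         +-mono-≤; +-monoˡ-≤; +-mono-<; +-monoˡ-<; *-monoˡ-≤)
import Data.Nat.Tactic.RingSolver as ℕ-Solver
open import Data.Parity as ℙ using (Parity; 0ℙ; 1ℙ)
import Data.Parity.Properties as ℙ
open import Data.Product using (_×_; _,_)
open import Data.Sum using (_⊎_; inj₁; inj₂)
open import Relation.Binary.PropositionalEquality
  using (refl; sym; trans; cong; subst; module ≡-Reasoning)
open import Relation.Nullary using (Dec; yes; no; does; proof; contradiction)
open import Relation.Nullary.Decidable using (_×-dec_)
open import Relation.Nullary.Reflects using (invert)

xyz-eq-neg-intro : ∀ {c x y z} → x ℕ.+ y ℕ.+ c ≡ z → xyz-eq (- + c) x y z
xyz-eq-neg-intro {c} {x} {y} refl = begin
  (+ x ℤ.+ + y) - + (x ℕ.+ y ℕ.+ c)       ≡⟨ cong (λ t → (+ x ℤ.+ + y) - t) pos-sum ⟩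
  (+ x ℤ.+ + y) - ((+ x ℤ.+ + y) ℤ.+ + c) ≡⟨ sub-sum (+ x ℤ.+ + y) (+ c) ⟩
  - + c                                    ∎
  where
  open ≡-Reasoning
  pos-sum : + (x ℕ.+ y ℕ.+ c) ≡ (+ x ℤ.+ + y) ℤ.+ + c
  pos-sum = trans (ℤ.pos-+ (x ℕ.+ y) c) (cong (ℤ._+ + c) (ℤ.pos-+ x y))
  sub-sum : ∀ (u v : ℤ) → u - (u ℤ.+ v) ≡ - v
  sub-sum = solve-∀

xyz-eq-neg-elim : ∀ {c x y z} → xyz-eq (- + c) x y z → x ℕ.+ y ℕ.+ c ≡ z
xyz-eq-neg-elim {c} {x} {y} {z} eq =
  ℤ.+-injective (ℤ.neg-injective (∙-cancelˡ (+ x ℤ.+ + y) _ _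
    (trans (xyz-eq-neg-intro {c} {x} {y} refl) (sym eq))))

point : ℕ → ℕ → ℕ
point c k = suc (k ℕ.* suc c)

point-sum : ∀ c i j → point c i ℕ.+ point c j ℕ.+ c ≡ point c (suc (i ℕ.+ j))
point-sum = unfolded
  where
  unfolded : ∀ c i j →
    suc (i ℕ.* suc c) ℕ.+ suc (j ℕ.* suc c) ℕ.+ c ≡ suc (suc (i ℕ.+ j) ℕ.* suc c)
  unfolded = ℕ-Solver.solve-∀

point-mono-≤ : ∀ c {i j} → i ≤ j → point c i ≤ point c j
point-mono-≤ c i≤j = s≤s (*-monoˡ-≤ (suc c) i≤j)

point-sum-< : ∀ c {i j x y} → point c i ℕ.< x → point c j ℕ.< y →
  point c (suc (i ℕ.+ j)) ℕ.< x ℕ.+ y ℕ.+ c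
point-sum-< c {i} {j} {x} {y} p q =
  subst (ℕ._< x ℕ.+ y ℕ.+ c) (point-sum c i j) (+-monoˡ-< c (+-mono-< p q))

point-sum-≤ : ∀ c {i j x y} → x ≤ point c i → y ≤ point c j →
  x ℕ.+ y ℕ.+ c ≤ point c (suc (i ℕ.+ j))
point-sum-≤ c {i} {j} {x} {y} p q =
  subst (x ℕ.+ y ℕ.+ c ≤_) (point-sum c i j) (+-monoˡ-≤ c (+-mono-≤ p q))

Monochromatic : {A : Set} → A → A → A → Set
Monochromatic u v w = u ≡ v × v ≡ w

-- The Schur triples u + v = w in [1,5] are 1+1=2, 2+2=4, 1+3=4, 1+4=5, 2+3=5.
HasMonochromaticSchurTriple : {A : Set} → A → A → A → A → A → Set
HasMonochromaticSchurTriple a₁ a₂ a₃ a₄ a₅ =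
  Monochromatic a₁ a₁ a₂ ⊎ Monochromatic a₂ a₂ a₄ ⊎ Monochromatic a₁ a₃ a₄ ⊎
  Monochromatic a₁ a₄ a₅ ⊎ Monochromatic a₂ a₃ a₅

schur-five : (a₁ a₂ a₃ a₄ a₅ : Fin 2) → HasMonochromaticSchurTriple a₁ a₂ a₃ a₄ a₅
schur-five zero       zero       _          _          _          = inj₁ (refl , refl)
schur-five (suc zero) (suc zero) _          _          _          = inj₁ (refl , refl)
schur-five zero       (suc zero) _          (suc zero) _          = inj₂ (inj₁ (refl , refl))
schur-five (suc zero) zero       _          zero       _          = inj₂ (inj₁ (refl , refl))
schur-five zero       (suc zero) zero       zero       _          = inj₂ (inj₂ (inj₁ (refl , refl)))
schur-five (suc zero) zero       (suc zero) (suc zero) _          = inj₂ (inj₂ (inj₁ (refl , refl)))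
schur-five zero       (suc zero) (suc zero) zero       zero       = inj₂ (inj₂ (inj₂ (inj₁ (refl , refl))))
schur-five (suc zero) zero       zero       (suc zero) (suc zero) = inj₂ (inj₂ (inj₂ (inj₁ (refl , refl))))
schur-five zero       (suc zero) (suc zero) zero       (suc zero) = inj₂ (inj₂ (inj₂ (inj₂ (refl , refl))))
schur-five (suc zero) zero       zero       (suc zero) zero       = inj₂ (inj₂ (inj₂ (inj₂ (refl , refl))))

point-solution : ∀ c {n} i j → point c (suc (i ℕ.+ j)) ≤ n →
  Sol (xyz-eq (- + c)) n (point c i) (point c j) (point c (suc (i ℕ.+ j)))
point-solution c {n} i j top≤n =
  inRange (m≤n⇒m≤1+n (m≤m+n i j)) , inRange (m≤n⇒m≤1+n (m≤n+m j i)) , inRange ≤-refl ,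
  xyz-eq-neg-intro {c} {point c i} {point c j} (point-sum c i j)
  where
  inRange : ∀ {k} → k ≤ suc (i ℕ.+ j) → InRange n (point c k)
  inRange k≤ = s≤s z≤n , ≤-trans (point-mono-≤ c k≤) top≤n

xyz-eq-neg-mono2 : ∀ c n → point c 4 ≤ n → Mono2 (xyz-eq (- + c)) n
xyz-eq-neg-mono2 c n top≤n χ =
  fromSchur (schur-five (χ (point c 0)) (χ (point c 1)) (χ (point c 2))
                        (χ (point c 3)) (χ (point c 4)))
  where
  MonochromaticSolution : Set
  MonochromaticSolution =
    ∃ λ x → ∃ λ y → ∃ λ z → Sol (xyz-eq (- + c)) n x y z × Monochromatic (χ x) (χ y) (χ z)

  solution : ∀ i j → suc (i ℕ.+ j) ≤ 4 →
    Monochromatic (χ (point c i)) (χ (point c j)) (χ (point c (suc (i ℕ.+ j)))) →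
    MonochromaticSolution
  solution i j top≤4 mono =
    _ , _ , _ , point-solution c i j (≤-trans (point-mono-≤ c top≤4) top≤n) , mono

  fromSchur : HasMonochromaticSchurTriple (χ (point c 0)) (χ (point c 1)) (χ (point c 2))
                (χ (point c 3)) (χ (point c 4)) →
              MonochromaticSolution
  fromSchur (inj₁ mono)                      = solution 0 0 (s≤s z≤n) mono
  fromSchur (inj₂ (inj₁ mono))               = solution 1 1 (n≤1+n 3) mono
  fromSchur (inj₂ (inj₂ (inj₁ mono)))        = solution 0 2 (n≤1+n 3) mono
  fromSchur (inj₂ (inj₂ (inj₂ (inj₁ mono)))) = solution 0 3 ≤-refl mono
  fromSchur (inj₂ (inj₂ (inj₂ (inj₂ mono)))) = solution 1 2 ≤-refl mono

parity-+-even : ∀ {c} m → parity c ≡ 0ℙ → parity (m ℕ.+ c) ≡ parity m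
parity-+-even {c} m even-c =
  trans (ℙ.+-homo-+ m c) (trans (cong (parity m ℙ.+_) even-c) (ℙ.+-identityʳ (parity m)))

even∧≥1⇒>1 : ∀ {x} → parity x ≡ 0ℙ → 1 ≤ x → 1 ℕ.< x
even∧≥1⇒>1 {suc (suc x)} _ _ = s≤s (s≤s z≤n)

Middle : ℕ → ℕ → Set
Middle c w = point c 1 ℕ.< w × w ≤ point c 3

middle? : ∀ c w → Dec (Middle c w)
middle? c w = point c 1 <? w ×-dec w ≤? point c 3

middle-sum-escapes : ∀ c {x y} → Middle c x → Middle c y → ¬ Middle c (x ℕ.+ y ℕ.+ c)
middle-sum-escapes c (a₁<x , _) (a₁<y , _) (_ , z≤a₃) = <⇒≱ (point-sum-< c {1} {1} a₁<x a₁<y) z≤a₃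

outer-sum-in-middle : ∀ c {x y} → 1 ℕ.< x → 1 ℕ.< y → x ℕ.+ y ℕ.+ c ≤ point c 4 →
  ¬ Middle c x → ¬ Middle c y → Middle c (x ℕ.+ y ℕ.+ c)
outer-sum-in-middle c {x} {y} 1<x 1<y z≤a₄ ¬mid-x ¬mid-y =
  point-sum-< c {0} {0} 1<x 1<y ,
  point-sum-≤ c {1} {1} (below ¬mid-x (λ a₃<x → point-sum-< c {3} {0} a₃<x 1<y))
                        (below ¬mid-y (λ a₃<y → point-sum-< c {0} {3} 1<x a₃<y))
  where
  below : ∀ {w} → ¬ Middle c w → (point c 3 ℕ.< w → point c 4 ℕ.< x ℕ.+ y ℕ.+ c) → w ≤ point c 1
  below ¬mid big = ≮⇒≥ λ a₁<w → ¬mid (a₁<w , ≮⇒≥ λ a₃<w → <⇒≱ (big a₃<w) z≤a₄)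

invert-does : ∀ {A : Set} {b} (a? : Dec A) → does a? ≡ b → if b then A else ¬ A
invert-does a? refl = invert (proof a?)

no-monochromatic-block : ∀ c {x y} b → 1 ℕ.< x → 1 ℕ.< y → x ℕ.+ y ℕ.+ c ≤ point c 4 →
  does (middle? c x) ≡ b → does (middle? c y) ≡ b → does (middle? c (x ℕ.+ y ℕ.+ c)) ≡ b → ⊥
no-monochromatic-block c {x} {y} true _ _ _ mid-x mid-y mid-z =
  middle-sum-escapes c (invert-does (middle? c x) mid-x) (invert-does (middle? c y) mid-y)
    (invert-does (middle? c _) mid-z)
no-monochromatic-block c {x} {y} false 1<x 1<y z≤a₄ mid-x mid-y mid-z =
  invert-does (middle? c _) mid-z
    (outer-sum-in-middle c 1<x 1<y z≤a₄
      (invert-does (middle? c x) mid-x) (invert-does (middle? c y) mid-y))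

colour : Parity → Bool → Fin 3
colour 1ℙ _     = zero
colour 0ℙ false = suc zero
colour 0ℙ true  = suc (suc zero)

blockColouring : ℕ → ℕ → Fin 3
blockColouring c w = colour (parity w) (does (middle? c w))

zero-sum-colours : ∀ {r} p q bx by bz → r ≡ p ℙ.+ q →
  (toℕ (colour p bx) ℕ.+ toℕ (colour q by) ℕ.+ toℕ (colour r bz)) ℕ.% 3 ≡ 0 →
  p ≡ 0ℙ × q ≡ 0ℙ × bx ≡ by × by ≡ bz
zero-sum-colours 1ℙ 1ℙ _     _     true  refl ()
zero-sum-colours 1ℙ 1ℙ _     _     false refl ()
zero-sum-colours 1ℙ 0ℙ _     true  _     refl ()
zero-sum-colours 1ℙ 0ℙ _     false _     refl ()
zero-sum-colours 0ℙ 1ℙ true  _     _     refl ()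
zero-sum-colours 0ℙ 1ℙ false _     _     refl ()
zero-sum-colours 0ℙ 0ℙ true  true  true  refl _  = refl , refl , refl , refl
zero-sum-colours 0ℙ 0ℙ true  true  false refl ()
zero-sum-colours 0ℙ 0ℙ true  false true  refl ()
zero-sum-colours 0ℙ 0ℙ true  false false refl ()
zero-sum-colours 0ℙ 0ℙ false true  true  refl ()
zero-sum-colours 0ℙ 0ℙ false true  false refl ()
zero-sum-colours 0ℙ 0ℙ false false true  refl ()
zero-sum-colours 0ℙ 0ℙ false false false refl _  = refl , refl , refl , refl

xyz-eq-neg-¬zeroSum3 : ∀ c → parity c ≡ 0ℙ → ∀ n → n ≤ point c 4 → ¬ ZeroSum3 (xyz-eq (- + c)) n
xyz-eq-neg-¬zeroSum3 c even-c n n≤a₄ zero-sum with zero-sum (blockColouring c)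
... | x , y , z , ((1≤x , _) , (1≤y , _) , (_ , z≤size) , x+y-z≡-c) , sum≡0
    with xyz-eq-neg-elim {c} {x} {y} {z} x+y-z≡-c
... | refl
    with zero-sum-colours (parity x) (parity y) _ _ _
           (trans (parity-+-even (x ℕ.+ y) even-c) (ℙ.+-homo-+ x y)) sum≡0
... | even-x , even-y , bx≡by , by≡bz =
  no-monochromatic-block c _ (even∧≥1⇒>1 even-x 1≤x) (even∧≥1⇒>1 even-y 1≤y)
    (≤-trans z≤size n≤a₄) bx≡by refl (sym by≡bz)

leastThresholds-differ : ∀ {P Q : ℕ → Set} {m} → (∀ n → m ≤ n → P n) → ¬ Q m →
  ¬ (∃ λ N → IsLeastThreshold P N × IsLeastThreshold Q N)
leastThresholds-differ {m = m} P-from-m ¬Q-m (N , (_ , P-minimal) , (Q-from-N , _)) with N ≤? m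
... | yes N≤m = ¬Q-m (Q-from-N m N≤m)
... | no  N≰m = P-minimal m (≰⇒> N≰m) P-from-m

negative-even : ∀ {d} k → d < + 0 → d ≡ + 2 * k → ∃ λ c → d ≡ - + c × parity c ≡ 0ℙ
negative-even (+ j) d<0 refl =
  contradiction (subst (_< + 0) (sym (ℤ.pos-* 2 j)) d<0) λ { (+<+ ()) }
negative-even -[1+ m ] _ refl =
  2 ℕ.* suc m ,
  trans (sym (ℤ.neg-distribʳ-* (+ 2) (+ suc m))) (cong -_ (sym (ℤ.pos-* 2 (suc m)))) ,
  ℙ.*-homo-* 2 (suc m)

corollary3 : (d : ℤ) → d < + 0 → (∃ λ k → d ≡ + 2 * k) →
    ¬ AdmitsEGZ (xyz-eq d)
corollary3 d d<0 (k , d≡2k) with negative-even k d<0 d≡2k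
... | c , refl , even-c =
  leastThresholds-differ (xyz-eq-neg-mono2 c) (xyz-eq-neg-¬zeroSum3 c even-c (point c 4) ≤-refl)
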